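{- Let $n$ be a positive integer, $p$ a prime dividing $n$, $\omega_1=e^{2\pi i/p}$ and $\omega_j=\omega_1^j$. Let $\prec$ be a term order on the monomials of $\mathbb{C}[x_1,\ldots,x_n]$. Let $[b]$ be an equivalence class of $D$ under $\equiv$, let $a$ be the $\prec$-minimal element of $[b]$, and suppose $b\ne a$. Then for each $0\le j\le p-1$ there exists $0\le m\le p-1$ such that $b-\omega_m a\in I(B_j)$.
   Context: $B=\{1,\omega_1,\ldots,\omega_{p-1}\}^n\subseteq\mathbb{C}^n$ and $B_j=\{(t_1,\ldots,t_n)\in B: t_1\cdots t_n=\omega_j\}$. $D=\{x_1^{u_1}\cdots x_n^{u_n}: 0\le u_i\le p-1\}$. Two monomials $x^u,x^v\in D$ are equivalent, $x^u\equiv x^v$, iff there is $0\le k\le p-1$ with $u_i+k\equiv v_i\pmod p$ for all $i$. $I(S)=\{f\in\mathbb{C}[x_1,\ldots,x_n]: f(s)=0\ \forall s\in S\}$. -}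

module Defs where

open import Level using (_⊔_)
open import Data.Nat using (ℕ; zero; suc; _<_; _+_; _%_; NonZero)
open import Data.Fin using (Fin; toℕ)
open import Data.Vec using (Vec; []; _∷_; map; zipWith; replicate; foldr; lookup)
open import Data.List using (List; []) renaming (_∷_ to _∷ₗ_)
open import Data.Product using (Σ; ∃; _×_; _,_)
open import Data.Sum using (_⊎_)
open import Relation.Nullary using (¬_)
open import Relation.Binary.PropositionalEquality using (_≡_)
open import Algebra.Bundles using (CommutativeRing)

-- Monomials x₁^u₁⋯xₙ^uₙ of K[x₁,…,xₙ] are identified with exponent vectors in ℕⁿ.
Mon : ℕ → Set
Mon n = Vec ℕ n

_·ₘ_ : ∀ {n} → Mon n → Mon n → Mon n
_·ₘ_ = zipWith _+_

oneₘ : ∀ {n} → Mon n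
oneₘ = replicate _ 0

record TermOrder (n : ℕ) : Set₁ where
  field
    _≺_         : Mon n → Mon n → Set
    irrefl      : ∀ u → ¬ (u ≺ u)
    trans       : ∀ {u v w} → u ≺ v → v ≺ w → u ≺ w
    total       : ∀ u v → u ≺ v ⊎ (u ≡ v ⊎ v ≺ u)
    one-least   : ∀ u → ¬ (u ≡ oneₘ) → oneₘ ≺ u
    mult-compat : ∀ {u v} w → u ≺ v → (u ·ₘ w) ≺ (v ·ₘ w)

-- D = {x^u : 0 ≤ uᵢ ≤ p-1}: exponent vectors with entries in Fin p.
DMon : ℕ → ℕ → Set
DMon p n = Vec (Fin p) n

toMon : ∀ {p n} → DMon p n → Mon n
toMon = map toℕ

_≡D_ : ∀ {p n} .{{_ : NonZero p}} → DMon p n → DMon p n → Set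
_≡D_ {p} {n} u v =
  ∃ λ (k : Fin p) → ∀ (i : Fin n) →
    (toℕ (lookup u i) + toℕ k) % p ≡ toℕ (lookup v i) % p

IsMinimalInClass : ∀ {p n} .{{_ : NonZero p}} → TermOrder n → DMon p n → DMon p n → Set
IsMinimalInClass {p} {n} T a b =
  (a ≡D b) × (∀ (c : DMon p n) → c ≡D b → c ≡ a ⊎ TermOrder._≺_ T (toMon a) (toMon c))

module _ {c ℓ} (K : CommutativeRing c ℓ) where
  open CommutativeRing K renaming (_+_ to _+ᴷ_; _*_ to _*ᴷ_)

  pow : Carrier → ℕ → Carrier
  pow x zero    = 1#
  pow x (suc k) = x *ᴷ pow x k

  IsField : Set (c ⊔ ℓ)
  IsField = ¬ (1# ≈ 0#) × (∀ x → ¬ (x ≈ 0#) → ∃ λ y → x *ᴷ y ≈ 1#)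

  IsPrimitiveRoot : ℕ → Carrier → Set ℓ
  IsPrimitiveRoot p ω = pow ω p ≈ 1# × (∀ k → 0 < k → k < p → ¬ (pow ω k ≈ 1#))

  Poly : ℕ → Set c
  Poly n = List (Carrier × Mon n)

  prodV : ∀ {n} → Vec Carrier n → Carrier
  prodV = foldr _ _*ᴷ_ 1#

  evalMon : ∀ {n} → Mon n → Vec Carrier n → Carrier
  evalMon u t = prodV (zipWith pow t u)

  evalPoly : ∀ {n} → Poly n → Vec Carrier n → Carrier
  evalPoly [] t = 0#
  evalPoly ((a , u) ∷ₗ f) t = (a *ᴷ evalMon u t) +ᴷ evalPoly f t

  InI : ∀ {n} → (Vec Carrier n → Set (c ⊔ ℓ)) → Poly n → Set (c ⊔ ℓ)
  InI S f = ∀ s → S s → evalPoly f s ≈ 0#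

  Bj : ∀ (p n : ℕ) → Carrier → Fin p → Vec Carrier n → Set (c ⊔ ℓ)
  Bj p n ω j t = (∃ λ (e : Vec (Fin p) n) → t ≡ map (λ eᵢ → pow ω (toℕ eᵢ)) e)
                 × (prodV t ≈ pow ω (toℕ j))

  binom : ∀ {p n} → Carrier → DMon p n → Fin p → DMon p n → Poly n
  binom ω b m a = (1# , toMon b) ∷ₗ ((- pow ω (toℕ m) , toMon a) ∷ₗ [])

-- If a ≡ b via the shift k, then at any point t whose coordinates are p-th roots
-- of unity the exponents of x^a and x^b only matter modulo p, so
-- x^b(t) = x^a(t) · (t₁⋯tₙ)^k.  On B_j the product t₁⋯tₙ is ω^j, hence x^b − ω^m x^a
-- vanishes on B_j for m = jk mod p.
module Submission where

open import Defs
open import Data.Nat as ℕ using (ℕ; zero; suc; _<_; NonZero; _%_)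
open import Data.Nat.Divisibility using (_∣_)
open import Data.Nat.Primality using (Prime)
open import Data.Nat.DivMod using (_mod_; m%n<n; m≡m%n+[m/n]*n)
import Data.Nat.Properties as ℕ
open import Data.Fin as Fin using (Fin; toℕ)
open import Data.Fin.Properties using (toℕ-fromℕ<)
open import Data.Vec using (Vec; []; _∷_; map; lookup)
open import Data.Vec.Relation.Unary.All using (All; []; _∷_; universal)
open import Data.Vec.Relation.Unary.All.Properties using (map⁺)
open import Data.Product using (∃; _,_)
open import Function using (_∘_)
open import Relation.Nullary using (¬_)
open import Relation.Binary.PropositionalEquality as ≡ using (_≡_)
open import Algebra.Bundles using (CommutativeRing)
import Algebra.Properties.CommutativeSemigroup as CommutativeSemigroupProperties
import Algebra.Properties.CommutativeSemiring.Exp as CommutativeSemiringExp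
import Algebra.Properties.Group as GroupProperties
import Algebra.Properties.Ring as RingProperties
import Relation.Binary.Reasoning.Setoid as SetoidReasoning

module _ {c ℓ} (K : CommutativeRing c ℓ) where
  open CommutativeRing K
  open CommutativeSemiringExp commutativeSemiring
  open CommutativeSemigroupProperties *-commutativeSemigroup using (interchange)
  open GroupProperties +-group using (x≈y⇒x∙y⁻¹≈ε)
  open RingProperties ring using (-‿distribˡ-*)
  open SetoidReasoning setoid

  pow≡^ : ∀ x k → pow K x k ≡ x ^ k
  pow≡^ x zero    = ≡.refl
  pow≡^ x (suc k) = ≡.cong (x *_) (pow≡^ x k)

  1^n≈1 : ∀ n → 1# ^ n ≈ 1#
  1^n≈1 zero    = refl
  1^n≈1 (suc n) = trans (*-identityˡ _) (1^n≈1 n)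

  IsRootOfUnity : ℕ → Carrier → Set ℓ
  IsRootOfUnity p x = x ^ p ≈ 1#

  module _ {p : ℕ} .{{_ : NonZero p}} {x : Carrier} (xᵖ≈1 : IsRootOfUnity p x) where

    ^-multiple-of-order : ∀ q → x ^ (q ℕ.* p) ≈ 1#
    ^-multiple-of-order q = begin
      x ^ (q ℕ.* p)  ≡⟨ ≡.cong (x ^_) (ℕ.*-comm q p) ⟩
      x ^ (p ℕ.* q)  ≈⟨ ^-assocʳ x p q ⟨
      (x ^ p) ^ q    ≈⟨ ^-congˡ q xᵖ≈1 ⟩
      1# ^ q         ≈⟨ 1^n≈1 q ⟩
      1#             ∎

    ^≈^-% : ∀ m → x ^ m ≈ x ^ (m % p)
    ^≈^-% m = begin
      x ^ m                                     ≡⟨ ≡.cong (x ^_) (m≡m%n+[m/n]*n m p) ⟩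
      x ^ (m % p ℕ.+ m ℕ./ p ℕ.* p)             ≈⟨ ^-homo-* x (m % p) _ ⟩
      x ^ (m % p) * x ^ (m ℕ./ p ℕ.* p)         ≈⟨ *-congˡ (^-multiple-of-order (m ℕ./ p)) ⟩
      x ^ (m % p) * 1#                          ≈⟨ *-identityʳ _ ⟩
      x ^ (m % p)                               ∎

    ^≈^-mod : ∀ m → x ^ m ≈ x ^ toℕ (m mod p)
    ^≈^-mod m = trans (^≈^-% m) (reflexive (≡.cong (x ^_) (≡.sym (toℕ-fromℕ< (m%n<n m p)))))

    ^-cong-% : ∀ {m n} → m % p ≡ n % p → x ^ m ≈ x ^ n
    ^-cong-% {m} {n} m≡n = trans (^≈^-% m) (trans (reflexive (≡.cong (x ^_) m≡n)) (sym (^≈^-% n)))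

    ^-shift : ∀ u k {v} → (u ℕ.+ k) % p ≡ v % p → x ^ v ≈ x ^ u * x ^ k
    ^-shift u k u+k≡v = trans (^-cong-% (≡.sym u+k≡v)) (^-homo-* x u k)

    ^-isRootOfUnity : ∀ e → IsRootOfUnity p (x ^ e)
    ^-isRootOfUnity e = begin
      (x ^ e) ^ p    ≈⟨ ^-assocʳ x e p ⟩
      x ^ (e ℕ.* p)  ≈⟨ ^-multiple-of-order e ⟩
      1#             ∎

  evalMon-shift : ∀ {p n} .{{_ : NonZero p}} (t : Vec Carrier n) → All (IsRootOfUnity p) t →
    (u v : DMon p n) (k : ℕ) →
    (∀ i → (toℕ (lookup u i) ℕ.+ k) % p ≡ toℕ (lookup v i) % p) →
    evalMon K (toMon v) t ≈ evalMon K (toMon u) t * prodV K t ^ k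
  evalMon-shift [] [] [] [] k _ = sym (trans (*-identityˡ _) (1^n≈1 k))
  evalMon-shift (x ∷ t) (xᵖ≈1 ∷ tᵖ≈1) (u ∷ us) (v ∷ vs) k u+k≡v = begin
    pow K x (toℕ v) * evalMon K (toMon vs) t
      ≡⟨ ≡.cong (_* _) (pow≡^ x (toℕ v)) ⟩
    x ^ toℕ v * evalMon K (toMon vs) t
      ≈⟨ *-cong (^-shift xᵖ≈1 (toℕ u) k (u+k≡v Fin.zero))
                (evalMon-shift t tᵖ≈1 us vs k (λ i → u+k≡v (Fin.suc i))) ⟩
    (x ^ toℕ u * x ^ k) * (evalMon K (toMon us) t * prodV K t ^ k)
      ≈⟨ interchange _ _ _ _ ⟩
    (x ^ toℕ u * evalMon K (toMon us) t) * (x ^ k * prodV K t ^ k)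
      ≈⟨ *-cong (reflexive (≡.cong (_* _) (≡.sym (pow≡^ x (toℕ u))))) (sym (^-distrib-* x _ k)) ⟩
    (pow K x (toℕ u) * evalMon K (toMon us) t) * (x * prodV K t) ^ k
      ∎

  powers-areRootsOfUnity : ∀ {p n} .{{_ : NonZero p}} {ω} → IsRootOfUnity p ω →
    (e : Vec (Fin p) n) → All (IsRootOfUnity p) (map (λ eᵢ → pow K ω (toℕ eᵢ)) e)
  powers-areRootsOfUnity {p} {ω = ω} ωᵖ≈1 = map⁺ ∘ universal λ eᵢ →
    ≡.subst (IsRootOfUnity p) (≡.sym (pow≡^ ω (toℕ eᵢ))) (^-isRootOfUnity ωᵖ≈1 (toℕ eᵢ))

  binom-vanishes : ∀ {p n} ω (b : DMon p n) m a t →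
    evalMon K (toMon b) t ≈ pow K ω (toℕ m) * evalMon K (toMon a) t →
    evalPoly K (binom K ω b m a) t ≈ 0#
  binom-vanishes ω b m a t xᵇ≈ωᵐxᵃ = begin
    1# * xᵇ + (- ωᵐ * xᵃ + 0#)   ≈⟨ +-cong (*-identityˡ xᵇ) (+-identityʳ _) ⟩
    xᵇ + - ωᵐ * xᵃ               ≈⟨ +-congˡ (-‿distribˡ-* ωᵐ xᵃ) ⟨
    xᵇ - ωᵐ * xᵃ                 ≈⟨ x≈y⇒x∙y⁻¹≈ε xᵇ≈ωᵐxᵃ ⟩
    0#                           ∎
    where
    xᵇ xᵃ ωᵐ : Carrier
    xᵇ = evalMon K (toMon b) t
    xᵃ = evalMon K (toMon a) t
    ωᵐ = pow K ω (toℕ m)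

lemma4p1 : ∀ {c ℓ} (K : CommutativeRing c ℓ) → IsField K →
    (n p : ℕ) .{{_ : NonZero p}} → 0 < n → Prime p → p ∣ n →
    (ω : CommutativeRing.Carrier K) → IsPrimitiveRoot K p ω →
    (T : TermOrder n) → (a b : DMon p n) →
    IsMinimalInClass T a b → ¬ (b ≡ a) →
    ∀ (j : Fin p) → ∃ λ (m : Fin p) → InI K (Bj K p n ω j) (binom K ω b m a)
lemma4p1 K _ n p _ _ _ ω (ωᵖ≈1 , _) _ a b ((k , a≡ᴰb) , _) _ j = m , vanishes
  where
  open CommutativeRing K
  open CommutativeSemiringExp commutativeSemiring
  open SetoidReasoning setoid
  m : Fin p
  m = (toℕ j ℕ.* toℕ k) mod p
  ωᵖ≈1′ : IsRootOfUnity K p ω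
  ωᵖ≈1′ = trans (reflexive (≡.sym (pow≡^ K ω p))) ωᵖ≈1
  vanishes : InI K (Bj K p n ω j) (binom K ω b m a)
  vanishes _ ((e , ≡.refl) , t₁⋯tₙ≈ωʲ) = binom-vanishes K ω b m a t (begin
    evalMon K (toMon b) t               ≈⟨ evalMon-shift K t (powers-areRootsOfUnity K ωᵖ≈1′ e) a b (toℕ k) a≡ᴰb ⟩
    xᵃ * prodV K t ^ toℕ k              ≈⟨ *-comm _ _ ⟩
    prodV K t ^ toℕ k * xᵃ              ≈⟨ *-congʳ (^-congˡ (toℕ k) t₁⋯tₙ≈ωʲ) ⟩
    pow K ω (toℕ j) ^ toℕ k * xᵃ        ≡⟨ ≡.cong (λ z → z ^ toℕ k * xᵃ) (pow≡^ K ω (toℕ j)) ⟩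
    (ω ^ toℕ j) ^ toℕ k * xᵃ            ≈⟨ *-congʳ (^-assocʳ ω (toℕ j) (toℕ k)) ⟩
    ω ^ (toℕ j ℕ.* toℕ k) * xᵃ          ≈⟨ *-congʳ (^≈^-mod K ωᵖ≈1′ _) ⟩
    ω ^ toℕ m * xᵃ                      ≡⟨ ≡.cong (_* xᵃ) (≡.sym (pow≡^ K ω (toℕ m))) ⟩
    pow K ω (toℕ m) * xᵃ                ∎)
    where
    t : Vec Carrier n
    t = map (λ eᵢ → pow K ω (toℕ eᵢ)) e
    xᵃ : Carrier
    xᵃ = evalMon K (toMon a) t
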